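{- For every integer $k\geq 2$, $\mathcal{S}_{3s}(1,k)=\mathbb{N}\setminus\{1\}$.
   Context: Let $V$ be a set of $v$ elements and let $k,t$ be positive integers with $t<k<v$. A block is a $k$-subset of $V$. A $\mu$-way $(v,k,t)$ trade of volume $m$ is a family $T=\{T_1,\dots,T_\mu\}$ of $\mu$ pairwise disjoint collections of blocks, each $T_i$ consisting of exactly $m$ blocks, such that for every $t$-subset $S$ of $V$, the number of blocks of $T_i$ containing $S$ is the same for all $i$. It is a Steiner trade if every $t$-subset of $V$ is contained in at most one block of each $T_i$. $\mathcal{S}_{\mu s}(t,k)$ denotes the set of all positive integers $m$ such that a $\mu$-way $(v,k,t)$ Steiner trade of volume $m$ exists for some $v$. Here $\mathbb{N}=\{1,2,3,\dots\}$. -}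

module Defs where

open import Data.Nat using (ℕ; _≤_; _<_)
open import Data.Fin using (Fin)
open import Data.Fin.Subset using (Subset; ∣_∣; _⊆_)
open import Data.Fin.Subset.Properties using (_⊆?_)
open import Data.List using (List; length; filter)
open import Data.List.Membership.Propositional using (_∈_)
open import Data.List.Relation.Unary.Unique.Propositional using (Unique)
open import Data.Product using (Σ; ∃; _×_)
open import Relation.Binary.PropositionalEquality using (_≡_; _≢_)
open import Data.Empty using (⊥)

IsBlock : (v k : ℕ) → Subset v → Set
IsBlock v k B = ∣ B ∣ ≡ k

count : {v : ℕ} → Subset v → List (Subset v) → ℕ
count S T = length (filter (λ B → S ⊆? B) T)

record IsTrade (μ v k t m : ℕ) (T : Fin μ → List (Subset v)) : Set where
  field
    blocks    : ∀ i → ∀ {B} → B ∈ T i → IsBlock v k B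
    distinct  : ∀ i → Unique (T i)
    volume    : ∀ i → length (T i) ≡ m
    disjoint  : ∀ i j → i ≢ j → ∀ {B} → B ∈ T i → B ∈ T j → ⊥
    balanced  : ∀ (S : Subset v) → ∣ S ∣ ≡ t → ∀ i j → count S (T i) ≡ count S (T j)

record IsSteinerTrade (μ v k t m : ℕ) (T : Fin μ → List (Subset v)) : Set where
  field
    trade   : IsTrade μ v k t m T
    steiner : ∀ (S : Subset v) → ∣ S ∣ ≡ t → ∀ i → count S (T i) ≤ 1

-- m ∈ 𝒮_{μs}(t,k): m is a positive integer and a μ-way (v,k,t) Steiner
-- trade of volume m exists for some v with t < k < v.
InSteinerSpectrum : (μ t k m : ℕ) → Set
InSteinerSpectrum μ t k m =
  1 ≤ m × Σ ℕ (λ v → t < k × k < v × Σ (Fin μ → List (Subset v)) (λ T → IsSteinerTrade μ v k t m T))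

module Submission where

-- For t = 1 a point is a 1-subset, so three partitions of the points into m blocks of size k,
-- no block lying in two of them, form a 3-way Steiner trade of volume m: every point is covered
-- exactly once by each partition.  For m = 2 the partitions are the three perfect matchings of K₄,
-- padded to blocks of size k; for m ≥ 3 the points form a k × m grid, the blocks are transversals
-- of the columns, and the three partitions differ only by the shifts 0, −1, +1 of the first
-- column.  Volume 1 is impossible: two one-block classes covering each point equally often have
-- the same block, contradicting disjointness.

open import Defs
open import Data.Bool.Properties using (not-injective; not-¬)
open import Data.Empty using (⊥-elim)
open import Data.Fin using (Fin; zero; suc; fromℕ; inject₁; lower₁; toℕ; combine; quotient; remainder)
open import Data.Fin.Properties
  using (0≢1+n; suc-injective; toℕ-injective; toℕ-inject₁; toℕ-fromℕ; toℕ-inject₁-≢; inject₁-lower₁; lower₁-inject₁′; combine-remQuot)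
open import Function using (_∘_; _⇔_; mk⇔; Equivalence)
open import Data.Fin.Subset using (Subset; ∣_∣; _⊆_; _∈_; ⁅_⁆; ∁; ⊤; ⊥; inside; outside)
open import Data.Fin.Subset.Properties
  using (_⊆?_; _∈?_; ⊆-antisym; x∈⁅x⁆; x∈⁅y⁆⇒x≡y; ∣⁅x⁆∣≡1; ∣⊤∣≡n; ∣⊥∣≡0; ∣∁p∣≡n∸∣p∣; x∈∁p⇒x∉p; x∉p⇒x∈∁p)
open import Data.Fin.Permutation using (Permutation′; permutation; id; flip; _⟨$⟩ʳ_; _⟨$⟩ˡ_; inverseˡ; inverseʳ)
open import Data.List using (List; []; _∷_; length; filter; tabulate)
open import Data.List.Properties using (length-tabulate; filter-accept; filter-reject; filter-none)
open import Data.List.Membership.Propositional using () renaming (_∈_ to _∈ₗ_)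
open import Data.List.Membership.Propositional.Properties using (∈-tabulate⁻)
open import Data.List.Relation.Unary.All.Properties using (tabulate⁺)
open import Data.List.Relation.Unary.Any using (here)
open import Data.List.Relation.Unary.Unique.Propositional.Properties using () renaming (tabulate⁺ to Unique-tabulate⁺)
open import Data.Nat as ℕ using (ℕ; suc; _+_; _*_; _∸_; _≤_; _<_; z≤n; s≤s)
open import Data.Nat.Properties using (≤-reflexive; +-identityʳ; m+n∸n≡m; m≢1+n+m; m≤m+n; m≤n⇒m≤1+n; m<m*n)
open import Data.Product using (∃; _×_; _,_)
open import Data.Vec as Vec using (_∷_; []; _++_; head; tail; concat; lookup)
open import Data.Vec.Properties using (++-injectiveˡ; lookup-concat; lookup∘tabulate; []=⇒lookup; lookup⇒[]=)
open import Relation.Binary.PropositionalEquality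
open import Relation.Nullary using (¬_; yes; no; contradiction)
open import Relation.Unary using (Pred; Decidable)

∣p++q∣≡∣p∣+∣q∣ : ∀ {a b} (p : Subset a) (q : Subset b) → ∣ p ++ q ∣ ≡ ∣ p ∣ + ∣ q ∣
∣p++q∣≡∣p∣+∣q∣ []            q = refl
∣p++q∣≡∣p∣+∣q∣ (inside ∷ p)  q = cong suc (∣p++q∣≡∣p∣+∣q∣ p q)
∣p++q∣≡∣p∣+∣q∣ (outside ∷ p) q = ∣p++q∣≡∣p∣+∣q∣ p q

∁-injective : ∀ {n} {p q : Subset n} → ∁ p ≡ ∁ q → p ≡ q
∁-injective {p = []}    {[]}    _ = refl
∁-injective {p = x ∷ p} {y ∷ q} e = cong₂ _∷_ (not-injective (cong head e)) (∁-injective (cong tail e))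

⁅⁆-injective : ∀ {n} {x y : Fin n} → ⁅ x ⁆ ≡ ⁅ y ⁆ → x ≡ y
⁅⁆-injective {x = x} {y} e = x∈⁅y⁆⇒x≡y y (subst (x ∈_) e (x∈⁅x⁆ x))

⁅x⁆⊆p⇒x∈p : ∀ {n} {x : Fin n} {p} → ⁅ x ⁆ ⊆ p → x ∈ p
⁅x⁆⊆p⇒x∈p {x = x} ⁅x⁆⊆p = ⁅x⁆⊆p (x∈⁅x⁆ x)

x∈p⇒⁅x⁆⊆p : ∀ {n} {x : Fin n} {p} → x ∈ p → ⁅ x ⁆ ⊆ p
x∈p⇒⁅x⁆⊆p {x = x} {p} x∈p y∈⁅x⁆ = subst (_∈ p) (sym (x∈⁅y⁆⇒x≡y x y∈⁅x⁆)) x∈p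

∣p∣≡0⇒p≡⊥ : ∀ {n} (p : Subset n) → ∣ p ∣ ≡ 0 → p ≡ ⊥
∣p∣≡0⇒p≡⊥ []            _ = refl
∣p∣≡0⇒p≡⊥ (outside ∷ p) e = cong (outside ∷_) (∣p∣≡0⇒p≡⊥ p e)

∣p∣≡1⇒p≡⁅x⁆ : ∀ {n} (p : Subset n) → ∣ p ∣ ≡ 1 → ∃ λ x → p ≡ ⁅ x ⁆
∣p∣≡1⇒p≡⁅x⁆ (inside ∷ p)  e = zero , cong (inside ∷_) (∣p∣≡0⇒p≡⊥ p (cong ℕ.pred e))
∣p∣≡1⇒p≡⁅x⁆ (outside ∷ p) e with ∣p∣≡1⇒p≡⁅x⁆ p e
... | x , p≡⁅x⁆ = suc x , cong (outside ∷_) p≡⁅x⁆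

filter-tabulate-unique : ∀ {a p} {A : Set a} {P : Pred A p} (P? : Decidable P) {n} (g : Fin n → A) {c : Fin n} →
                         P (g c) → (∀ i → P (g i) → i ≡ c) → filter P? (tabulate g) ≡ g c ∷ []
filter-tabulate-unique P? g {zero} Pgc unique = begin
  filter P? (tabulate g)                  ≡⟨ filter-accept P? Pgc ⟩
  g zero ∷ filter P? (tabulate (g ∘ suc)) ≡⟨ cong (g zero ∷_) (filter-none P? (tabulate⁺ λ i Pgi → 0≢1+n (sym (unique (suc i) Pgi)))) ⟩
  g zero ∷ []                             ∎
  where open ≡-Reasoning
filter-tabulate-unique P? g {suc c} Pgc unique = begin
  filter P? (tabulate g)          ≡⟨ filter-reject P? (λ Pg0 → 0≢1+n (unique zero Pg0)) ⟩
  filter P? (tabulate (g ∘ suc))  ≡⟨ filter-tabulate-unique P? (g ∘ suc) Pgc (λ i Pgi → suc-injective (unique (suc i) Pgi)) ⟩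
  g (suc c) ∷ []                  ∎
  where open ≡-Reasoning

x∈p⇒count⁅x⁆[p]≡1 : ∀ {n} {x : Fin n} {p} → x ∈ p → count ⁅ x ⁆ (p ∷ []) ≡ 1
x∈p⇒count⁅x⁆[p]≡1 x∈p = cong length (filter-accept (⁅ _ ⁆ ⊆?_) (x∈p⇒⁅x⁆⊆p x∈p))

count⁅x⁆[p]≡1⇒x∈p : ∀ {n} {x : Fin n} {p} → count ⁅ x ⁆ (p ∷ []) ≡ 1 → x ∈ p
count⁅x⁆[p]≡1⇒x∈p {x = x} {p} count≡1 with ⁅ x ⁆ ⊆? p
... | yes ⁅x⁆⊆p = ⁅x⁆⊆p⇒x∈p ⁅x⁆⊆p
... | no _ with () ← count≡1

length≡1⇒singleton : ∀ {a} {A : Set a} (xs : List A) → length xs ≡ 1 → ∃ λ x → xs ≡ x ∷ []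
length≡1⇒singleton (x ∷ []) refl = x , refl

¬IsTrade-volume1 : ∀ {μ v k} {T : Fin (2 + μ) → List (Subset v)} → ¬ IsTrade (2 + μ) v k 1 1 T
¬IsTrade-volume1 {T = T} trade
  with length≡1⇒singleton (T zero) (IsTrade.volume trade zero)
     | length≡1⇒singleton (T (suc zero)) (IsTrade.volume trade (suc zero))
... | B , T₀≡[B] | C , T₁≡[C] = disjoint zero (suc zero) (λ ()) B∈T₀ B∈T₁
  where
  open IsTrade trade
  same-count : ∀ x → count ⁅ x ⁆ (B ∷ []) ≡ count ⁅ x ⁆ (C ∷ [])
  same-count x = subst₂ (λ T₀ T₁ → count ⁅ x ⁆ T₀ ≡ count ⁅ x ⁆ T₁) T₀≡[B] T₁≡[C]
                        (balanced ⁅ x ⁆ (∣⁅x⁆∣≡1 x) zero (suc zero))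
  B≡C : B ≡ C
  B≡C = ⊆-antisym (λ {x} x∈B → count⁅x⁆[p]≡1⇒x∈p (trans (sym (same-count x)) (x∈p⇒count⁅x⁆[p]≡1 x∈B)))
                  (λ {x} x∈C → count⁅x⁆[p]≡1⇒x∈p (trans (same-count x) (x∈p⇒count⁅x⁆[p]≡1 x∈C)))
  B∈T₀ : B ∈ₗ T zero
  B∈T₀ = subst (B ∈ₗ_) (sym T₀≡[B]) (here refl)
  B∈T₁ : B ∈ₗ T (suc zero)
  B∈T₁ = subst (B ∈ₗ_) (sym T₁≡[C]) (here B≡C)

record Partition (v k m : ℕ) : Set where
  field
    block           : Fin m → Subset v
    ∣block∣≡k       : ∀ i → ∣ block i ∣ ≡ k
    block-injective : ∀ {i j} → block i ≡ block j → i ≡ j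
    owner           : Fin v → Fin m
    ∈-owner         : ∀ x → x ∈ block (owner x)
    ∈⇒≡owner        : ∀ {x i} → x ∈ block i → i ≡ owner x

  blocks : List (Subset v)
  blocks = tabulate block

  count-point≡1 : ∀ {S} → ∣ S ∣ ≡ 1 → count S blocks ≡ 1
  count-point≡1 {S} ∣S∣≡1 with ∣p∣≡1⇒p≡⁅x⁆ S ∣S∣≡1
  ... | x , refl = cong length (filter-tabulate-unique (⁅ x ⁆ ⊆?_) block (x∈p⇒⁅x⁆⊆p (∈-owner x))
                                                       (λ i ⁅x⁆⊆block → ∈⇒≡owner (⁅x⁆⊆p⇒x∈p ⁅x⁆⊆block)))

open Partition using (block; blocks)

Separated : ∀ {μ v k m} → (Fin μ → Partition v k m) → Set
Separated P = ∀ {s s'} i j → block (P s) i ≡ block (P s') j → s ≡ s'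

partitions⇒IsSteinerTrade : ∀ {μ v k m} (P : Fin μ → Partition v k m) → Separated P →
                            IsSteinerTrade μ v k 1 m (blocks ∘ P)
partitions⇒IsSteinerTrade P separated = record
  { trade = record
    { blocks   = λ s B∈ → let i , B≡ = ∈-tabulate⁻ B∈ in trans (cong ∣_∣ B≡) (Partition.∣block∣≡k (P s) i)
    ; distinct = λ s → Unique-tabulate⁺ (Partition.block-injective (P s))
    ; volume   = λ s → length-tabulate (block (P s))
    ; disjoint = λ s s' s≢s' B∈s B∈s' → let i , B≡i = ∈-tabulate⁻ B∈s ; j , B≡j = ∈-tabulate⁻ B∈s' in
                   s≢s' (separated i j (trans (sym B≡i) B≡j))
    ; balanced = λ S ∣S∣≡1 s s' → trans (count-point≡1 (P s) ∣S∣≡1) (sym (count-point≡1 (P s') ∣S∣≡1))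
    }
  ; steiner = λ S ∣S∣≡1 s → ≤-reflexive (count-point≡1 (P s) ∣S∣≡1)
  }
  where open Partition using (count-point≡1)

p≢∁p : ∀ {n} (p : Subset (suc n)) → p ≢ ∁ p
p≢∁p (x ∷ p) p≡∁p = not-¬ refl (cong head p≡∁p)

complementPartition : ∀ {v k} (A : Subset (suc v)) → ∣ A ∣ ≡ k → ∣ ∁ A ∣ ≡ k → Partition (suc v) k 2
complementPartition {v} {k} A ∣A∣≡k ∣∁A∣≡k = record
  { block = side ; ∣block∣≡k = ∣side∣≡k ; block-injective = side-injective
  ; owner = owner ; ∈-owner = ∈-owner ; ∈⇒≡owner = ∈⇒≡owner }
  where
  side : Fin 2 → Subset (suc v)
  side zero       = A
  side (suc zero) = ∁ A

  ∣side∣≡k : ∀ i → ∣ side i ∣ ≡ k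
  ∣side∣≡k zero       = ∣A∣≡k
  ∣side∣≡k (suc zero) = ∣∁A∣≡k

  side-injective : ∀ {i j} → side i ≡ side j → i ≡ j
  side-injective {zero}     {zero}     _ = refl
  side-injective {zero}     {suc zero} e = ⊥-elim (p≢∁p A e)
  side-injective {suc zero} {zero}     e = ⊥-elim (p≢∁p A (sym e))
  side-injective {suc zero} {suc zero} _ = refl

  owner : Fin (suc v) → Fin 2
  owner x with x ∈? A
  ... | yes _ = zero
  ... | no  _ = suc zero

  ∈-owner : ∀ x → x ∈ side (owner x)
  ∈-owner x with x ∈? A
  ... | yes x∈A = x∈A
  ... | no  x∉A = x∉p⇒x∈∁p x∉A

  ∈⇒≡owner : ∀ {x i} → x ∈ side i → i ≡ owner x
  ∈⇒≡owner {x} {zero} x∈A with x ∈? A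
  ... | yes _   = refl
  ... | no  x∉A = contradiction x∈A x∉A
  ∈⇒≡owner {x} {suc zero} x∈∁A with x ∈? A
  ... | yes x∈A = contradiction x∈A (x∈∁p⇒x∉p x∈∁A)
  ... | no  _   = refl

module VolumeTwo (k : ℕ) where

  padding : Subset (k + k)
  padding = ⊤ {k} ++ ⊥ {k}

  ∣padding∣≡k : ∣ padding ∣ ≡ k
  ∣padding∣≡k = begin
    ∣ ⊤ {k} ++ ⊥ {k} ∣     ≡⟨ ∣p++q∣≡∣p∣+∣q∣ (⊤ {k}) ⊥ ⟩
    ∣ ⊤ {k} ∣ + ∣ ⊥ {k} ∣  ≡⟨ cong₂ _+_ (∣⊤∣≡n k) (∣⊥∣≡0 k) ⟩
    k + 0                  ≡⟨ +-identityʳ k ⟩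
    k                      ∎
    where open ≡-Reasoning

  -- Restricted to the first four points, the halves of the three classes are the three perfect
  -- matchings of K₄; the padding is split alike by every class.
  half : Fin 3 → Subset (4 + (k + k))
  half s = outside ∷ (∁ ⁅ s ⁆ ++ padding)

  ∣half∣≡2+k : ∀ s → ∣ half s ∣ ≡ 2 + k
  ∣half∣≡2+k s = begin
    ∣ ∁ ⁅ s ⁆ ++ padding ∣        ≡⟨ ∣p++q∣≡∣p∣+∣q∣ (∁ ⁅ s ⁆) padding ⟩
    ∣ ∁ ⁅ s ⁆ ∣ + ∣ padding ∣     ≡⟨ cong₂ _+_ (∣∁p∣≡n∸∣p∣ ⁅ s ⁆) ∣padding∣≡k ⟩
    3 ∸ ∣ ⁅ s ⁆ ∣ + k             ≡⟨ cong (λ a → 3 ∸ a + k) (∣⁅x⁆∣≡1 s) ⟩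
    2 + k                         ∎
    where open ≡-Reasoning

  ∣∁half∣≡2+k : ∀ s → ∣ ∁ (half s) ∣ ≡ 2 + k
  ∣∁half∣≡2+k s = begin
    ∣ ∁ (half s) ∣               ≡⟨ ∣∁p∣≡n∸∣p∣ (half s) ⟩
    (4 + (k + k)) ∸ ∣ half s ∣   ≡⟨ cong (4 + (k + k) ∸_) (∣half∣≡2+k s) ⟩
    ((2 + k) + k) ∸ k            ≡⟨ m+n∸n≡m (2 + k) k ⟩
    2 + k                        ∎
    where open ≡-Reasoning

  half-injective : ∀ {s s'} → half s ≡ half s' → s ≡ s'
  half-injective {s} {s'} e = ⁅⁆-injective (∁-injective (++-injectiveˡ (∁ ⁅ s ⁆) (∁ ⁅ s' ⁆) (cong tail e)))

  halving : Fin 3 → Partition (4 + (k + k)) (2 + k) 2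
  halving s = complementPartition (half s) (∣half∣≡2+k s) (∣∁half∣≡2+k s)

  halving-separated : Separated halving
  halving-separated zero       zero       e = half-injective e
  halving-separated zero       (suc zero) ()
  halving-separated (suc zero) zero       ()
  halving-separated (suc zero) (suc zero) e = half-injective (∁-injective e)

transversal : ∀ {a b} → (Fin a → Fin b) → Subset (a * b)
transversal f = concat (Vec.tabulate λ c → ⁅ f c ⁆)

∣transversal∣≡a : ∀ {a b} (f : Fin a → Fin b) → ∣ transversal f ∣ ≡ a
∣transversal∣≡a {ℕ.zero} f = refl
∣transversal∣≡a {suc a} f = begin
  ∣ ⁅ f zero ⁆ ++ transversal (f ∘ suc) ∣     ≡⟨ ∣p++q∣≡∣p∣+∣q∣ ⁅ f zero ⁆ (transversal (f ∘ suc)) ⟩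
  ∣ ⁅ f zero ⁆ ∣ + ∣ transversal (f ∘ suc) ∣  ≡⟨ cong₂ _+_ (∣⁅x⁆∣≡1 (f zero)) (∣transversal∣≡a (f ∘ suc)) ⟩
  suc a                                      ∎
  where open ≡-Reasoning

combine∈transversal⇔ : ∀ {a b} (f : Fin a → Fin b) c r → combine c r ∈ transversal f ⇔ r ≡ f c
combine∈transversal⇔ f c r = mk⇔
  (λ x∈ → x∈⁅y⁆⇒x≡y (f c) (lookup⇒[]= r ⁅ f c ⁆ (trans (sym lookup-combine) ([]=⇒lookup x∈))))
  (λ r≡fc → lookup⇒[]= (combine c r) (transversal f)
                       (trans lookup-combine ([]=⇒lookup (subst (_∈ ⁅ f c ⁆) (sym r≡fc) (x∈⁅x⁆ (f c))))))
  where
  lookup-combine : lookup (transversal f) (combine c r) ≡ lookup ⁅ f c ⁆ r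
  lookup-combine = trans (lookup-concat (Vec.tabulate λ c → ⁅ f c ⁆) c r)
                         (cong (λ p → lookup p r) (lookup∘tabulate (λ c → ⁅ f c ⁆) c))

∈transversal⇔ : ∀ {a b} (f : Fin a → Fin b) x → x ∈ transversal f ⇔ remainder {a} b x ≡ f (quotient b x)
∈transversal⇔ {a} {b} f x = subst (λ y → y ∈ transversal f ⇔ remainder {a} b x ≡ f (quotient b x))
                                  (combine-remQuot {a} b x) (combine∈transversal⇔ f (quotient b x) (remainder {a} b x))

transversal-injective : ∀ {a b} {f g : Fin a → Fin b} → transversal f ≡ transversal g → ∀ c → f c ≡ g c
transversal-injective {f = f} {g} f≡g c =
  Equivalence.to (combine∈transversal⇔ g c (f c))
    (subst (combine c (f c) ∈_) f≡g (Equivalence.from (combine∈transversal⇔ f c (f c)) refl))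

permutation-injective : ∀ {m} (π : Permutation′ m) {i j} → π ⟨$⟩ʳ i ≡ π ⟨$⟩ʳ j → i ≡ j
permutation-injective π {i} {j} πi≡πj = begin
  i                     ≡⟨ sym (inverseˡ π) ⟩
  π ⟨$⟩ˡ (π ⟨$⟩ʳ i)      ≡⟨ cong (π ⟨$⟩ˡ_) πi≡πj ⟩
  π ⟨$⟩ˡ (π ⟨$⟩ʳ j)      ≡⟨ inverseˡ π ⟩
  j                     ∎
  where open ≡-Reasoning

≡⟨$⟩ˡ⇒⟨$⟩ʳ≡ : ∀ {m} (π : Permutation′ m) {i j} → j ≡ π ⟨$⟩ˡ i → π ⟨$⟩ʳ j ≡ i
≡⟨$⟩ˡ⇒⟨$⟩ʳ≡ π j≡π⁻¹i = trans (cong (π ⟨$⟩ʳ_) j≡π⁻¹i) (inverseʳ π)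

-- Points are the cells combine c r of a (1 + a) × m grid; block i meets column c in row π c i.
transversalPartition : ∀ {a m} → (Fin (suc a) → Permutation′ m) → Partition (suc a * m) (suc a) m
transversalPartition {a} {m} π = record
  { block           = line
  ; ∣block∣≡k       = λ i → ∣transversal∣≡a (row i)
  ; block-injective = line-injective
  ; owner           = owner
  ; ∈-owner         = ∈-owner
  ; ∈⇒≡owner        = ∈⇒≡owner
  }
  where
  row : Fin m → Fin (suc a) → Fin m
  row i c = π c ⟨$⟩ʳ i

  line : Fin m → Subset (suc a * m)
  line i = transversal (row i)

  line-injective : ∀ {i j} → line i ≡ line j → i ≡ j
  line-injective {i} {j} line-i≡line-j =
    permutation-injective (π zero) (transversal-injective {f = row i} {row j} line-i≡line-j zero)

  column : Fin (suc a * m) → Fin (suc a)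
  column = quotient m

  height : Fin (suc a * m) → Fin m
  height = remainder {suc a} m

  owner : Fin (suc a * m) → Fin m
  owner x = π (column x) ⟨$⟩ˡ height x

  ∈-owner : ∀ x → x ∈ line (owner x)
  ∈-owner x = Equivalence.from (∈transversal⇔ (row (owner x)) x) (sym (inverseʳ (π (column x))))

  ∈⇒≡owner : ∀ {x i} → x ∈ line i → i ≡ owner x
  ∈⇒≡owner {x} {i} x∈line = begin
    i                                    ≡⟨ sym (inverseˡ (π (column x))) ⟩
    π (column x) ⟨$⟩ˡ row i (column x)    ≡⟨ cong (π (column x) ⟨$⟩ˡ_) (sym (Equivalence.to (∈transversal⇔ (row i) x) x∈line)) ⟩
    owner x                              ∎
    where open ≡-Reasoning

predMod : ∀ {n} → Fin (suc n) → Fin (suc n)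
predMod {n} zero    = fromℕ n
predMod     (suc i) = inject₁ i

sucMod : ∀ {n} → Fin (suc n) → Fin (suc n)
sucMod {n} i with n ℕ.≟ toℕ i
... | yes _   = zero
... | no  n≢i = suc (lower₁ i n≢i)

predMod-sucMod : ∀ {n} (i : Fin (suc n)) → predMod (sucMod i) ≡ i
predMod-sucMod {n} i with n ℕ.≟ toℕ i
... | yes n≡i = toℕ-injective (trans (toℕ-fromℕ n) n≡i)
... | no  n≢i = inject₁-lower₁ i n≢i

sucMod-predMod : ∀ {n} (i : Fin (suc n)) → sucMod (predMod i) ≡ i
sucMod-predMod {n} zero with n ℕ.≟ toℕ (fromℕ n)
... | yes _   = refl
... | no  n≢n = contradiction (sym (toℕ-fromℕ n)) n≢n
sucMod-predMod {n} (suc i) with n ℕ.≟ toℕ (inject₁ i)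
... | yes n≡i = contradiction n≡i (toℕ-inject₁-≢ i)
... | no  n≢i = cong suc (lower₁-inject₁′ i n≢i)

rotation : ∀ {n} → Permutation′ (suc n)
rotation = permutation predMod sucMod predMod-sucMod sucMod-predMod

predMod-fixpoint-free : ∀ {n} (i : Fin (2 + n)) → predMod i ≢ i
predMod-fixpoint-free zero    ()
predMod-fixpoint-free (suc i) e = m≢1+n+m (toℕ i) {0} (trans (sym (toℕ-inject₁ i)) (cong toℕ e))

predMod²-fixpoint-free : ∀ {n} (i : Fin (3 + n)) → predMod (predMod i) ≢ i
predMod²-fixpoint-free zero          ()
predMod²-fixpoint-free (suc zero)    ()
predMod²-fixpoint-free (suc (suc i)) e =
  m≢1+n+m (toℕ i) {1} (trans (sym (trans (toℕ-inject₁ (inject₁ i)) (toℕ-inject₁ i))) (cong toℕ e))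

shifts : ∀ {m} → Permutation′ m → Fin 3 → Permutation′ m
shifts ρ zero             = id
shifts ρ (suc zero)       = ρ
shifts ρ (suc (suc zero)) = flip ρ

shifts-separating : ∀ {m} (ρ : Permutation′ m) → (∀ i → ρ ⟨$⟩ʳ i ≢ i) → (∀ i → ρ ⟨$⟩ʳ (ρ ⟨$⟩ʳ i) ≢ i) →
                    ∀ {s s'} i → shifts ρ s ⟨$⟩ʳ i ≡ shifts ρ s' ⟨$⟩ʳ i → s ≡ s'
shifts-separating ρ ρ-fpf ρ²-fpf {zero}           {zero}           i _ = refl
shifts-separating ρ ρ-fpf ρ²-fpf {suc zero}       {suc zero}       i _ = refl
shifts-separating ρ ρ-fpf ρ²-fpf {suc (suc zero)} {suc (suc zero)} i _ = refl
shifts-separating ρ ρ-fpf ρ²-fpf {zero}           {suc zero}       i e = ⊥-elim (ρ-fpf i (sym e))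
shifts-separating ρ ρ-fpf ρ²-fpf {suc zero}       {zero}           i e = ⊥-elim (ρ-fpf i e)
shifts-separating ρ ρ-fpf ρ²-fpf {zero}           {suc (suc zero)} i e = ⊥-elim (ρ-fpf i (≡⟨$⟩ˡ⇒⟨$⟩ʳ≡ ρ e))
shifts-separating ρ ρ-fpf ρ²-fpf {suc (suc zero)} {zero}           i e = ⊥-elim (ρ-fpf i (≡⟨$⟩ˡ⇒⟨$⟩ʳ≡ ρ (sym e)))
shifts-separating ρ ρ-fpf ρ²-fpf {suc zero}       {suc (suc zero)} i e = ⊥-elim (ρ²-fpf i (≡⟨$⟩ˡ⇒⟨$⟩ʳ≡ ρ e))
shifts-separating ρ ρ-fpf ρ²-fpf {suc (suc zero)} {suc zero}       i e = ⊥-elim (ρ²-fpf i (≡⟨$⟩ˡ⇒⟨$⟩ʳ≡ ρ (sym e)))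

module VolumeAtLeastThree (k n : ℕ) where

  columnShift : Fin 3 → Fin (2 + k) → Permutation′ (3 + n)
  columnShift s zero    = shifts rotation s
  columnShift s (suc _) = id

  row : Fin 3 → Fin (3 + n) → Fin (2 + k) → Fin (3 + n)
  row s i c = columnShift s c ⟨$⟩ʳ i

  grid : Fin 3 → Partition ((2 + k) * (3 + n)) (2 + k) (3 + n)
  grid s = transversalPartition (columnShift s)

  grid-separated : Separated grid
  grid-separated {s} {s'} i j e with transversal-injective {f = row s i} {row s' j} e (suc zero)
  -- Column 1 is unshifted, so i ≡ j; column 0 then compares the shifts of s and s'.
  ... | refl = shifts-separating rotation predMod-fixpoint-free predMod²-fixpoint-free i
                 (transversal-injective {f = row s i} {row s' i} e zero)

partitions⇒InSteinerSpectrum : ∀ {μ v k m} (P : Fin μ → Partition v k m) → Separated P →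
                               1 ≤ m → 1 < k → k < v → InSteinerSpectrum μ 1 k m
partitions⇒InSteinerSpectrum {v = v} P separated 1≤m 1<k k<v =
  1≤m , v , 1<k , k<v , blocks ∘ P , partitions⇒IsSteinerTrade P separated

InSteinerSpectrum⇒2≤m : ∀ {μ k m} → InSteinerSpectrum (2 + μ) 1 k m → 2 ≤ m
InSteinerSpectrum⇒2≤m {m = 0}           (() , _)
InSteinerSpectrum⇒2≤m {m = 1}           (_ , _ , _ , _ , _ , steinerTrade) =
  ⊥-elim (¬IsTrade-volume1 (IsSteinerTrade.trade steinerTrade))
InSteinerSpectrum⇒2≤m {m = suc (suc m)} _ = s≤s (s≤s z≤n)

2≤m⇒InSteinerSpectrum : ∀ {k m} → 2 ≤ k → 2 ≤ m → InSteinerSpectrum 3 1 k m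
2≤m⇒InSteinerSpectrum (s≤s (s≤s (z≤n {k}))) (s≤s (s≤s (z≤n {0}))) =
  partitions⇒InSteinerSpectrum halving halving-separated (s≤s z≤n) (s≤s (s≤s z≤n))
    (s≤s (s≤s (s≤s (m≤n⇒m≤1+n (m≤m+n k k)))))
  where open VolumeTwo k
2≤m⇒InSteinerSpectrum (s≤s (s≤s (z≤n {k}))) (s≤s (s≤s (z≤n {suc n}))) =
  partitions⇒InSteinerSpectrum grid grid-separated (s≤s z≤n) (s≤s (s≤s z≤n))
    (m<m*n (2 + k) (3 + n) (s≤s (s≤s z≤n)))
  where open VolumeAtLeastThree k n

theorem3p4 : (k : ℕ) → 2 ≤ k → (m : ℕ) → (InSteinerSpectrum 3 1 k m → 2 ≤ m) × (2 ≤ m → InSteinerSpectrum 3 1 k m)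
theorem3p4 k 2≤k m = InSteinerSpectrum⇒2≤m , 2≤m⇒InSteinerSpectrum 2≤k
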